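{- Let $G$ be a simple graph on $\{v_1,\dots,v_n\}$ with degree sequence $d_1,\dots,d_n$, $\sum_i d_i=2m$, $d_{\max}=\max_i d_i$. Let $0\le r\le m$ and let $H$ be a subgraph of $G$ with exactly $r$ edges, with residual degrees $d_i^{(r)}=d_i-\deg_H(v_i)$. Define $$\Delta_r=\sum_{i=1}^n\binom{d_i^{(r)}}{2}+\sum_{\{i,j\}\in E(H)}d_i^{(r)}d_j^{(r)},\qquad \Lambda_{r,1}=\sum_{i=1}^n d_i^{(r)}d_i,$$ $$\Lambda_r=\sum_{\substack{\{i,j\}:\ i\neq j,\\ \{i,j\}\notin E(H)}}d_i^{(r)}d_j^{(r)}\frac{d_id_j}{4m}.$$ Then (i) $\Delta_r\le\frac{(2m-2r)d_{\max}^2}{2}$; (ii) $\Lambda_{r,1}\le d_{\max}(2m-2r)$; (iii) $\Lambda_r\le\frac{(2m-2r)^2d_{\max}^2}{8m}$.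
   Context: Here $H$ plays the role of the partial graph formed by the first $r$ edges of an ordering of the edges of $G$; $\Delta_r$ counts the pairs of remaining mini-vertices (in the configuration model with $d_i$ mini-vertices for $v_i$) that would create a self-loop or a double edge, and $\Lambda_r$ is the total correction weight $\frac{d_id_j}{4m}$ of the remaining admissible pairs. Note $\sum_i d_i^{(r)}=2m-2r$. -}

module Defs where

open import Data.Nat using (ℕ; zero; suc; _+_; _*_; _∸_; _⊔_)
open import Data.Fin using (Fin; zero; suc; _<?_)
open import Data.Bool using (Bool; true; false; if_then_else_; _∧_; not)
open import Relation.Nullary.Decidable using (does)
open import Relation.Binary.PropositionalEquality using (_≡_)

∑ : (n : ℕ) → (Fin n → ℕ) → ℕ
∑ zero    f = 0
∑ (suc n) f = f zero + ∑ n (λ i → f (suc i))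

maxF : (n : ℕ) → (Fin n → ℕ) → ℕ
maxF zero    f = 0
maxF (suc n) f = f zero ⊔ maxF n (λ i → f (suc i))

-- sum of f i j over unordered pairs {i,j}, i ≠ j, satisfying P
-- (each unordered pair counted once, via i < j)
pairSum : (n : ℕ) → (Fin n → Fin n → Bool) → (Fin n → Fin n → ℕ) → ℕ
pairSum n P f = ∑ n (λ i → ∑ n (λ j → if does (i <? j) ∧ P i j then f i j else 0))

record SimpleGraph (n : ℕ) : Set where
  field
    adj   : Fin n → Fin n → Bool
    sym   : ∀ i j → adj i j ≡ adj j i
    irrefl : ∀ i → adj i i ≡ false
open SimpleGraph public

deg : {n : ℕ} → SimpleGraph n → Fin n → ℕ
deg {n} G i = ∑ n (λ j → if adj G i j then 1 else 0)

numEdges : {n : ℕ} → SimpleGraph n → ℕ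
numEdges {n} G = pairSum n (adj G) (λ _ _ → 1)

_⊆G_ : {n : ℕ} → SimpleGraph n → SimpleGraph n → Set
_⊆G_ {n} H G = ∀ i j → adj H i j ≡ true → adj G i j ≡ true

{-# OPTIONS --safe #-}
-- By the handshake lemma for H, the residual degrees sum to S = 2m − 2r, and
-- every degree and residual degree is at most dmax; hence Λ_{r,1} = Σ dr_i d_i ≤ dmax S.
-- A sum over unordered pairs is half the ordered double sum over a symmetric summand,
-- so 2Λ_r ≤ (Σ dr_i d_i)² ≤ (dmax S)². For Δ_r, the H-edge part doubles to
-- Σ_i dr_i Σ_{j ∼_H i} dr_j ≤ dmax Σ_i dr_i deg_H(i), and 2·C(x,2) ≤ x² ≤ dmax x² for
-- x ≤ dmax; as dr_i + deg_H(i) = d_i, this gives 2Δ_r ≤ dmax Λ_{r,1} ≤ dmax² S.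
module Submission where

open import Defs
open import Data.Nat using (ℕ; _+_; _*_; _∸_; _≤_)
open import Data.Nat.Combinatorics using (_C_)
open import Data.Fin using (Fin)
open import Data.Bool using (if_then_else_; not; _∧_)
open import Data.Product using (_×_)
open import Relation.Binary.PropositionalEquality using (_≡_)

open import Data.Nat using (zero; suc; z≤n)
open import Data.Nat.Properties
open import Data.Nat.Combinatorics using (nCk+nC[k+1]≡[n+1]C[k+1]; nC1≡n)
open import Data.Nat.Solver using (module +-*-Solver)
open import Data.Fin using (zero; suc)
open import Data.Bool using (Bool; true; false)
open import Data.Product using (_,_)
open import Function using (_∘_)
open import Relation.Binary.PropositionalEquality
  using (_≗_; refl; trans; cong; cong₂; module ≡-Reasoning)
import Relation.Binary.PropositionalEquality as ≡
import Algebra.Properties.Semiring.Sum +-*-semiring as Sum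
open import Algebra.Properties.CommutativeSemigroup *-commutativeSemigroup
  using () renaming (interchange to *-interchange; x∙yz≈y∙xz to x*[y*z]≡y*[x*z])

open +-*-Solver using (solve; _:=_; _:+_; _:*_; con)

∑≗sum : ∀ n (f : Fin n → ℕ) → ∑ n f ≡ Sum.sum f
∑≗sum zero    f = refl
∑≗sum (suc n) f = cong (f zero +_) (∑≗sum n (f ∘ suc))

∑-cong : ∀ n {f g : Fin n → ℕ} → f ≗ g → ∑ n f ≡ ∑ n g
∑-cong zero    f≗g = refl
∑-cong (suc n) f≗g = cong₂ _+_ (f≗g zero) (∑-cong n (f≗g ∘ suc))

∑-mono-≤ : ∀ n {f g : Fin n → ℕ} → (∀ i → f i ≤ g i) → ∑ n f ≤ ∑ n g
∑-mono-≤ zero    f≤g = z≤n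
∑-mono-≤ (suc n) f≤g = +-mono-≤ (f≤g zero) (∑-mono-≤ n (f≤g ∘ suc))

∑-zero : ∀ n {f : Fin n → ℕ} → (∀ i → f i ≡ 0) → ∑ n f ≡ 0
∑-zero n f≗0 = trans (∑-cong n f≗0) (trans (∑≗sum n _) (Sum.sum-replicate-zero n))

∑-distrib-+ : ∀ n (f g : Fin n → ℕ) → ∑ n (λ i → f i + g i) ≡ ∑ n f + ∑ n g
∑-distrib-+ n f g
  rewrite ∑≗sum n (λ i → f i + g i) | ∑≗sum n f | ∑≗sum n g = Sum.∑-distrib-+ f g

*-distribˡ-∑ : ∀ n c (f : Fin n → ℕ) → c * ∑ n f ≡ ∑ n (λ i → c * f i)
*-distribˡ-∑ n c f
  rewrite ∑≗sum n f | ∑≗sum n (λ i → c * f i) = Sum.*-distribˡ-sum c f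

*-distribʳ-∑ : ∀ n c (f : Fin n → ℕ) → ∑ n f * c ≡ ∑ n (λ i → f i * c)
*-distribʳ-∑ n c f
  rewrite ∑≗sum n f | ∑≗sum n (λ i → f i * c) = Sum.*-distribʳ-sum c f

∑-∸ : ∀ n {f g : Fin n → ℕ} → (∀ i → g i ≤ f i) → ∑ n (λ i → f i ∸ g i) ≡ ∑ n f ∸ ∑ n g
∑-∸ n {f} {g} g≤f = begin
  ∑ n (λ i → f i ∸ g i)                       ≡⟨ ≡.sym (m+n∸n≡m _ (∑ n g)) ⟩
  ∑ n (λ i → f i ∸ g i) + ∑ n g ∸ ∑ n g       ≡⟨ cong (_∸ ∑ n g) (≡.sym (∑-distrib-+ n _ g)) ⟩
  ∑ n (λ i → f i ∸ g i + g i) ∸ ∑ n g         ≡⟨ cong (_∸ ∑ n g) (∑-cong n (m∸n+n≡m ∘ g≤f)) ⟩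
  ∑ n f ∸ ∑ n g                               ∎
  where open ≡-Reasoning

∑-*-bound : ∀ n {c} (f g : Fin n → ℕ) → (∀ i → g i ≤ c) → ∑ n (λ i → f i * g i) ≤ c * ∑ n f
∑-*-bound n {c} f g g≤c = begin
  ∑ n (λ i → f i * g i)   ≤⟨ ∑-mono-≤ n (λ i → *-monoʳ-≤ (f i) (g≤c i)) ⟩
  ∑ n (λ i → f i * c)     ≡⟨ ≡.sym (*-distribʳ-∑ n c f) ⟩
  ∑ n f * c               ≡⟨ *-comm (∑ n f) c ⟩
  c * ∑ n f               ∎
  where open ≤-Reasoning

maxF-upper : ∀ n (f : Fin n → ℕ) i → f i ≤ maxF n f
maxF-upper (suc n) f zero    = m≤m⊔n (f zero) _
maxF-upper (suc n) f (suc i) = ≤-trans (maxF-upper n (f ∘ suc) i) (m≤n⊔m (f zero) _)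

if-≤ : ∀ b x → (if b then x else 0) ≤ x
if-≤ true  x = ≤-refl
if-≤ false x = z≤n

if-*ˡ : ∀ b x y → (if b then x * y else 0) ≡ x * (if b then y else 0)
if-*ˡ true  x y = refl
if-*ˡ false x y = ≡.sym (*-zeroʳ x)

pairSum-cong : ∀ n (P : Fin n → Fin n → Bool) {f g : Fin n → Fin n → ℕ} →
  (∀ i j → f i j ≡ g i j) → pairSum n P f ≡ pairSum n P g
pairSum-cong n P f≗g =
  ∑-cong n (λ i → ∑-cong n (λ j → cong (λ x → if _ then x else 0) (f≗g i j)))

pairSum-double : ∀ n (P : Fin n → Fin n → Bool) (f : Fin n → Fin n → ℕ) →
  (∀ i j → P i j ≡ P j i) → (∀ i j → f i j ≡ f j i) →
  ∑ n (λ i → ∑ n (λ j → if P i j then f i j else 0))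
    ≡ 2 * pairSum n P f + ∑ n (λ i → if P i i then f i i else 0)
-- pairSum (suc n) unfolds definitionally into the zeroth row plus pairSum over the
-- remaining vertices; the zeroth column of the double sum equals that row by symmetry.
pairSum-double zero    P f P-sym f-sym = refl
pairSum-double (suc n) P f P-sym f-sym = begin
    h₀₀ + row + ∑ n (λ i → h (suc i) zero + ∑ n (h (suc i) ∘ suc))
  ≡⟨ cong (h₀₀ + row +_) (∑-distrib-+ n _ _) ⟩
    h₀₀ + row + (column + ∑ n (λ i → ∑ n (h (suc i) ∘ suc)))
  ≡⟨ cong₂ (λ c rest → h₀₀ + row + (c + rest)) column≡row
       (pairSum-double n P′ f′ (λ i j → P-sym (suc i) (suc j)) (λ i j → f-sym (suc i) (suc j))) ⟩
    h₀₀ + row + (row + (2 * pairSum n P′ f′ + diagonal′))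
  ≡⟨ solve 4 (λ a r q e → a :+ r :+ (r :+ (con 2 :* q :+ e)) := con 2 :* (r :+ q) :+ (a :+ e))
       refl h₀₀ row (pairSum n P′ f′) diagonal′ ⟩
    2 * (row + pairSum n P′ f′) + (h₀₀ + diagonal′)
  ∎
  where
  open ≡-Reasoning
  P′ : Fin n → Fin n → Bool
  P′ i j = P (suc i) (suc j)
  f′ : Fin n → Fin n → ℕ
  f′ i j = f (suc i) (suc j)
  h : Fin (suc n) → Fin (suc n) → ℕ
  h i j = if P i j then f i j else 0
  h₀₀ row column diagonal′ : ℕ
  h₀₀ = h zero zero
  row = ∑ n (h zero ∘ suc)
  column = ∑ n (λ i → h (suc i) zero)
  diagonal′ = ∑ n (λ i → h (suc i) (suc i))
  column≡row : column ≡ row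
  column≡row = ∑-cong n (λ i → cong₂ (λ b x → if b then x else 0) (P-sym (suc i) zero) (f-sym (suc i) zero))

2*pairSum≤∑∑ : ∀ n (P : Fin n → Fin n → Bool) (f : Fin n → Fin n → ℕ) →
  (∀ i j → P i j ≡ P j i) → (∀ i j → f i j ≡ f j i) →
  2 * pairSum n P f ≤ ∑ n (λ i → ∑ n (λ j → if P i j then f i j else 0))
2*pairSum≤∑∑ n P f P-sym f-sym =
  ≤-trans (m≤m+n _ _) (≤-reflexive (≡.sym (pairSum-double n P f P-sym f-sym)))

2*pairSum≡∑∑ : ∀ n (P : Fin n → Fin n → Bool) (f : Fin n → Fin n → ℕ) →
  (∀ i j → P i j ≡ P j i) → (∀ i j → f i j ≡ f j i) → (∀ i → P i i ≡ false) →
  2 * pairSum n P f ≡ ∑ n (λ i → ∑ n (λ j → if P i j then f i j else 0))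
2*pairSum≡∑∑ n P f P-sym f-sym P-irrefl = begin
  2 * pairSum n P f                                           ≡⟨ ≡.sym (+-identityʳ _) ⟩
  2 * pairSum n P f + 0                                       ≡⟨ cong (2 * pairSum n P f +_) no-diagonal ⟩
  2 * pairSum n P f + ∑ n (λ i → if P i i then f i i else 0)  ≡⟨ ≡.sym (pairSum-double n P f P-sym f-sym) ⟩
  ∑ n (λ i → ∑ n (λ j → if P i j then f i j else 0))          ∎
  where
  open ≡-Reasoning
  no-diagonal : 0 ≡ ∑ n (λ i → if P i i then f i i else 0)
  no-diagonal = ≡.sym (∑-zero n (λ i → cong (λ b → if b then f i i else 0) (P-irrefl i)))

handshake : ∀ {n} (G : SimpleGraph n) → ∑ n (deg G) ≡ 2 * numEdges G
handshake {n} G = ≡.sym (2*pairSum≡∑∑ n (adj G) (λ _ _ → 1) (SimpleGraph.sym G) (λ _ _ → refl) (irrefl G))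

deg-mono : ∀ {n} {H G : SimpleGraph n} → H ⊆G G → ∀ i → deg H i ≤ deg G i
deg-mono {n} {H} {G} H⊆G i = ∑-mono-≤ n edge≤
  where
  edge≤ : ∀ j → (if adj H i j then 1 else 0) ≤ (if adj G i j then 1 else 0)
  edge≤ j with adj H i j in H-edge
  ... | true rewrite H⊆G i j H-edge = ≤-refl
  ... | false = z≤n

2*nC2+n≡n*n : ∀ n → 2 * (n C 2) + n ≡ n * n
2*nC2+n≡n*n zero    = refl
2*nC2+n≡n*n (suc n) = begin
  2 * (suc n C 2) + suc n            ≡⟨ cong (λ c → 2 * c + suc n) (≡.sym (nCk+nC[k+1]≡[n+1]C[k+1] n 1)) ⟩
  2 * (n C 1 + n C 2) + suc n        ≡⟨ cong (λ c → 2 * (c + n C 2) + suc n) (nC1≡n n) ⟩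
  2 * (n + n C 2) + suc n            ≡⟨ solve 2 (λ n c → con 2 :* (n :+ c) :+ (con 1 :+ n)
                                          := (con 2 :* c :+ n) :+ (con 1 :+ con 2 :* n)) refl n (n C 2) ⟩
  (2 * (n C 2) + n) + suc (2 * n)    ≡⟨ cong (_+ suc (2 * n)) (2*nC2+n≡n*n n) ⟩
  n * n + suc (2 * n)                ≡⟨ solve 1 (λ n → n :* n :+ (con 1 :+ con 2 :* n)
                                          := (con 1 :+ n) :* (con 1 :+ n)) refl n ⟩
  suc n * suc n                      ∎
  where open ≡-Reasoning

m≤n⇒m*k≤n*[m*k] : ∀ {m n} k → m ≤ n → m * k ≤ n * (m * k)
m≤n⇒m*k≤n*[m*k] {zero}          k _ = z≤n
m≤n⇒m*k≤n*[m*k] {suc m} {suc n} k _ = m≤n*m (suc m * k) (suc n)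

2*∑C2≤ : ∀ n (x : Fin n → ℕ) {D} → (∀ i → x i ≤ D) →
  2 * ∑ n (λ i → x i C 2) ≤ D * ∑ n (λ i → x i * x i)
2*∑C2≤ n x {D} x≤D = begin
  2 * ∑ n (λ i → x i C 2)       ≡⟨ *-distribˡ-∑ n 2 _ ⟩
  ∑ n (λ i → 2 * (x i C 2))     ≤⟨ ∑-mono-≤ n (λ i → m+n≤o⇒m≤o _ (≤-reflexive (2*nC2+n≡n*n (x i)))) ⟩
  ∑ n (λ i → x i * x i)         ≤⟨ ∑-mono-≤ n (λ i → m≤n⇒m*k≤n*[m*k] (x i) (x≤D i)) ⟩
  ∑ n (λ i → D * (x i * x i))   ≡⟨ ≡.sym (*-distribˡ-∑ n D _) ⟩
  D * ∑ n (λ i → x i * x i)     ∎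
  where open ≤-Reasoning

∑-neighbours≤ : ∀ {n} (H : SimpleGraph n) (x : Fin n → ℕ) {D} → (∀ j → x j ≤ D) →
  ∀ i → ∑ n (λ j → if adj H i j then x j else 0) ≤ D * deg H i
∑-neighbours≤ {n} H x {D} x≤D i = begin
  ∑ n (λ j → if adj H i j then x j else 0)        ≤⟨ ∑-mono-≤ n neighbour≤ ⟩
  ∑ n (λ j → D * (if adj H i j then 1 else 0))    ≡⟨ ≡.sym (*-distribˡ-∑ n D _) ⟩
  D * deg H i                                     ∎
  where
  open ≤-Reasoning
  neighbour≤ : ∀ j → (if adj H i j then x j else 0) ≤ D * (if adj H i j then 1 else 0)
  neighbour≤ j with adj H i j
  ... | true  = ≤-trans (x≤D j) (≤-reflexive (≡.sym (*-identityʳ D)))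
  ... | false = z≤n

2*pairSum-adj≤ : ∀ {n} (H : SimpleGraph n) (x : Fin n → ℕ) {D} → (∀ i → x i ≤ D) →
  2 * pairSum n (adj H) (λ i j → x i * x j) ≤ D * ∑ n (λ i → x i * deg H i)
2*pairSum-adj≤ {n} H x {D} x≤D = begin
  2 * pairSum n (adj H) (λ i j → x i * x j)
    ≡⟨ 2*pairSum≡∑∑ n (adj H) _ (SimpleGraph.sym H) (λ i j → *-comm (x i) (x j)) (irrefl H) ⟩
  ∑ n (λ i → ∑ n (λ j → if adj H i j then x i * x j else 0))
    ≡⟨ ∑-cong n (λ i → trans (∑-cong n (λ j → if-*ˡ (adj H i j) (x i) (x j))) (≡.sym (*-distribˡ-∑ n (x i) _))) ⟩
  ∑ n (λ i → x i * ∑ n (λ j → if adj H i j then x j else 0))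
    ≤⟨ ∑-mono-≤ n (λ i → *-monoʳ-≤ (x i) (∑-neighbours≤ H x x≤D i)) ⟩
  ∑ n (λ i → x i * (D * deg H i))
    ≡⟨ ∑-cong n (λ i → x*[y*z]≡y*[x*z] (x i) D (deg H i)) ⟩
  ∑ n (λ i → D * (x i * deg H i))
    ≡⟨ ≡.sym (*-distribˡ-∑ n D _) ⟩
  D * ∑ n (λ i → x i * deg H i)
    ∎
  where open ≤-Reasoning

2*∑C2+pairSum-adj≤ : ∀ {n} (H : SimpleGraph n) (x : Fin n → ℕ) {D} → (∀ i → x i ≤ D) →
  2 * (∑ n (λ i → x i C 2) + pairSum n (adj H) (λ i j → x i * x j))
    ≤ D * ∑ n (λ i → x i * (x i + deg H i))
2*∑C2+pairSum-adj≤ {n} H x {D} x≤D = begin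
  2 * (∑ n (λ i → x i C 2) + pairSum n (adj H) (λ i j → x i * x j))
    ≡⟨ *-distribˡ-+ 2 (∑ n (λ i → x i C 2)) _ ⟩
  2 * ∑ n (λ i → x i C 2) + 2 * pairSum n (adj H) (λ i j → x i * x j)
    ≤⟨ +-mono-≤ (2*∑C2≤ n x x≤D) (2*pairSum-adj≤ H x x≤D) ⟩
  D * ∑ n (λ i → x i * x i) + D * ∑ n (λ i → x i * deg H i)
    ≡⟨ ≡.sym (*-distribˡ-+ D _ _) ⟩
  D * (∑ n (λ i → x i * x i) + ∑ n (λ i → x i * deg H i))
    ≡⟨ cong (D *_) (≡.sym (∑-distrib-+ n _ _)) ⟩
  D * ∑ n (λ i → x i * x i + x i * deg H i)
    ≡⟨ cong (D *_) (∑-cong n (λ i → ≡.sym (*-distribˡ-+ (x i) (x i) (deg H i)))) ⟩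
  D * ∑ n (λ i → x i * (x i + deg H i))
    ∎
  where open ≤-Reasoning

2*pairSum-product≤square : ∀ n (P : Fin n → Fin n → Bool) (a : Fin n → ℕ) →
  (∀ i j → P i j ≡ P j i) → 2 * pairSum n P (λ i j → a i * a j) ≤ ∑ n a * ∑ n a
2*pairSum-product≤square n P a P-sym = begin
  2 * pairSum n P (λ i j → a i * a j)
    ≤⟨ 2*pairSum≤∑∑ n P _ P-sym (λ i j → *-comm (a i) (a j)) ⟩
  ∑ n (λ i → ∑ n (λ j → if P i j then a i * a j else 0))
    ≤⟨ ∑-mono-≤ n (λ i → ∑-mono-≤ n (λ j → if-≤ (P i j) _)) ⟩
  ∑ n (λ i → ∑ n (λ j → a i * a j))
    ≡⟨ ∑-cong n (λ i → ≡.sym (*-distribˡ-∑ n (a i) a)) ⟩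
  ∑ n (λ i → a i * ∑ n a)
    ≡⟨ ≡.sym (*-distribʳ-∑ n (∑ n a) a) ⟩
  ∑ n a * ∑ n a
    ∎
  where open ≤-Reasoning

module Residual {n} (G H : SimpleGraph n) (H⊆G : H ⊆G G) where

  d dr : Fin n → ℕ
  d = deg G
  dr i = d i ∸ deg H i

  D : ℕ
  D = maxF n d

  d≤D : ∀ i → d i ≤ D
  d≤D = maxF-upper n d

  deg-H≤d : ∀ i → deg H i ≤ d i
  deg-H≤d = deg-mono {H = H} {G} H⊆G

  dr≤D : ∀ i → dr i ≤ D
  dr≤D i = ≤-trans (m∸n≤m (d i) (deg H i)) (d≤D i)

  ∑dr≡∑d∸2|H| : ∑ n dr ≡ ∑ n d ∸ 2 * numEdges H
  ∑dr≡∑d∸2|H| = trans (∑-∸ n deg-H≤d) (cong (∑ n d ∸_) (handshake H))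

  Λ₁-bound : ∑ n (λ i → dr i * d i) ≤ D * ∑ n dr
  Λ₁-bound = ∑-*-bound n dr d d≤D

  Δ-bound : 2 * (∑ n (λ i → dr i C 2) + pairSum n (adj H) (λ i j → dr i * dr j)) ≤ ∑ n dr * (D * D)
  Δ-bound = begin
    2 * (∑ n (λ i → dr i C 2) + pairSum n (adj H) (λ i j → dr i * dr j))
      ≤⟨ 2*∑C2+pairSum-adj≤ H dr dr≤D ⟩
    D * ∑ n (λ i → dr i * (dr i + deg H i))
      ≡⟨ cong (D *_) (∑-cong n (λ i → cong (dr i *_) (m∸n+n≡m (deg-H≤d i)))) ⟩
    D * ∑ n (λ i → dr i * d i)
      ≤⟨ *-monoʳ-≤ D Λ₁-bound ⟩
    D * (D * ∑ n dr)
      ≡⟨ solve 2 (λ D S → D :* (D :* S) := S :* (D :* D)) refl D (∑ n dr) ⟩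
    ∑ n dr * (D * D)
      ∎
    where open ≤-Reasoning

  Λ-bound : 2 * pairSum n (λ i j → not (adj H i j)) (λ i j → dr i * dr j * (d i * d j))
              ≤ ∑ n dr * ∑ n dr * (D * D)
  Λ-bound = begin
    2 * pairSum n (λ i j → not (adj H i j)) (λ i j → dr i * dr j * (d i * d j))
      ≡⟨ cong (2 *_) (pairSum-cong n _ (λ i j → *-interchange (dr i) (dr j) (d i) (d j))) ⟩
    2 * pairSum n (λ i j → not (adj H i j)) (λ i j → (dr i * d i) * (dr j * d j))
      ≤⟨ 2*pairSum-product≤square n _ (λ i → dr i * d i) (λ i j → cong not (SimpleGraph.sym H i j)) ⟩
    ∑ n (λ i → dr i * d i) * ∑ n (λ i → dr i * d i)
      ≤⟨ *-mono-≤ Λ₁-bound Λ₁-bound ⟩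
    (D * ∑ n dr) * (D * ∑ n dr)
      ≡⟨ solve 2 (λ D S → (D :* S) :* (D :* S) := S :* S :* (D :* D)) refl D (∑ n dr) ⟩
    ∑ n dr * ∑ n dr * (D * D)
      ∎
    where open ≤-Reasoning

lemma8 : (n m r : ℕ) (G H : SimpleGraph n)
    → ∑ n (deg G) ≡ 2 * m
    → r ≤ m
    → H ⊆G G
    → numEdges H ≡ r
    → let d    = deg G
          dr   = λ (i : Fin n) → deg G i ∸ deg H i
          dmax = maxF n d
      in (2 * (∑ n (λ i → dr i C 2) + pairSum n (adj H) (λ i j → dr i * dr j))
            ≤ (2 * m ∸ 2 * r) * (dmax * dmax))
         × (∑ n (λ i → dr i * d i) ≤ dmax * (2 * m ∸ 2 * r))
         × (2 * pairSum n (λ i j → not (adj H i j)) (λ i j → dr i * dr j * (d i * d j))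
            ≤ (2 * m ∸ 2 * r) * (2 * m ∸ 2 * r) * (dmax * dmax))
lemma8 n m r G H ∑d≡2m _ H⊆G |H|≡r
  rewrite ≡.sym ∑d≡2m | ≡.sym |H|≡r | ≡.sym (Residual.∑dr≡∑d∸2|H| G H H⊆G)
  = Δ-bound , Λ₁-bound , Λ-bound
  where open Residual G H H⊆G
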